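{- Let $G=(V,E)$ be a finite directed graph and let $k\geq 0$ be an integer. Let $\mathrm{Ent}(G,k)$ be the entanglement game on $G$ with $k$ cops, and let $\mathrm{ET}(G,k)$ be the modified game, both as defined in the context. Then Cops has a winning strategy in $\mathrm{Ent}(G,k)$ if and only if Cops has a winning strategy in $\mathrm{ET}(G,k)$.
   Context: The entanglement game $\mathrm{Ent}(G,k)$ on a finite directed graph $G=(V,E)$ is played by two players, Thief and Cops. Positions are triples $(g,C,P)$ with $g\in V$ (the position of the Thief), $C\subseteq V$ with $|C|\leq k$ (the vertices occupied by cops), and $P\in\{\mathrm{Cops},\mathrm{Thief}\}$ (the player to move). A play starts with Thief choosing a vertex $g_0\in V$, giving the position $(g_0,\emptyset,\mathrm{Cops})$. Thief moves are $(g,C,\mathrm{Thief})\rightarrow(g',C,\mathrm{Cops})$, where $(g,g')\in E$ and $g'\notin C$. Cops moves in $\mathrm{Ent}(G,k)$ are of three kinds: - skip: $(g,C,\mathrm{Cops})\rightarrow(g,C,\mathrm{Thief})$; - add: $(g,C,\mathrm{Cops})\rightarrow(g,C\cup\{g\},\mathrm{Thief})$, allowed if $|C|<k$; - replace: $(g,C,\mathrm{Cops})\rightarrow(g,(C\setminus\{x\})\cup\{g\},\mathrm{Thief})$ for some $x\in C$. If Thief has no legal move when it is his turn, then Thief is trapped and Cops wins. Thief wins every infinite play. The game $\mathrm{ET}(G,k)$ is played exactly like $\mathrm{Ent}(G,k)$, with the same positions, the same start, the same Thief moves and the same winning conditions, except that Cops may also retire cops. Its Cops moves are: - generalized skip: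 $(g,C,\mathrm{Cops})\rightarrow(g,C',\mathrm{Thief})$ with $C'\subseteq C$; - generalized replace: $(g,C,\mathrm{Cops})\rightarrow(g,C'\cup\{g\},\mathrm{Thief})$ with $C'\subseteq C$ and $|C'\cup\{g\}|\leq k$. -}

module Defs where

open import Data.Nat using (ℕ; suc; _≤_; _<_)
open import Data.Bool using (Bool; true)
open import Data.Fin using (Fin)
open import Data.Fin.Subset using (Subset; ⊥; ⁅_⁆; _∪_; _-_; _∈_; _∉_; _⊆_; ∣_∣)
open import Data.List using (List; map; upTo)
open import Data.Product using (Σ; ∃; ∃-syntax; _×_; _,_)
open import Data.Sum using (_⊎_)
open import Relation.Binary.PropositionalEquality using (_≡_)
open import Relation.Nullary using (¬_)

record Graph : Set where
  field
    n : ℕ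
    E : Fin n → Fin n → Bool

data Player : Set where
  Cops Thief : Player

-- Positions (g, C, P).  The bound |C| ≤ k is enforced by the moves
-- (every position reachable from a start position satisfies it).
record Pos (n : ℕ) : Set where
  constructor pos
  field
    thief  : Fin n
    cops   : Subset n
    player : Player
open Pos public

data EntCopsMove {n : ℕ} (k : ℕ) : Pos n → Pos n → Set where
  skip    : ∀ {g C} → EntCopsMove k (pos g C Cops) (pos g C Thief)
  add     : ∀ {g C} → ∣ C ∣ < k →
            EntCopsMove k (pos g C Cops) (pos g (C ∪ ⁅ g ⁆) Thief)
  replace : ∀ {g C} (x : Fin n) → x ∈ C →
            EntCopsMove k (pos g C Cops) (pos g ((C - x) ∪ ⁅ g ⁆) Thief)

data ETCopsMove {n : ℕ} (k : ℕ) : Pos n → Pos n → Set where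
  gskip    : ∀ {g C} (C' : Subset n) → C' ⊆ C →
             ETCopsMove k (pos g C Cops) (pos g C' Thief)
  greplace : ∀ {g C} (C' : Subset n) → C' ⊆ C → ∣ C' ∪ ⁅ g ⁆ ∣ ≤ k →
             ETCopsMove k (pos g C Cops) (pos g (C' ∪ ⁅ g ⁆) Thief)

data ThiefMove (G : Graph) : Pos (Graph.n G) → Pos (Graph.n G) → Set where
  move : ∀ {g g' C} → Graph.E G g g' ≡ true → g' ∉ C →
         ThiefMove G (pos g C Thief) (pos g' C Cops)

CopsMoveRel : ℕ → Set₁
CopsMoveRel n = Pos n → Pos n → Set

data Move (G : Graph) (CM : CopsMoveRel (Graph.n G))
          : Pos (Graph.n G) → Pos (Graph.n G) → Set where
  copsMove  : ∀ {p q} → CM p q → Move G CM p q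
  thiefMove : ∀ {p q} → ThiefMove G p q → Move G CM p q

record Strategy (G : Graph) (CM : CopsMoveRel (Graph.n G)) : Set where
  field
    next  : List (Pos (Graph.n G)) → Pos (Graph.n G) → Pos (Graph.n G)
    legal : ∀ h p → player p ≡ Cops → CM p (next h p)
open Strategy public

record InfinitePlay (G : Graph) (CM : CopsMoveRel (Graph.n G))
                    (σ : Strategy G CM) : Set where
  field
    play    : ℕ → Pos (Graph.n G)
    start   : ∃[ g₀ ] play 0 ≡ pos g₀ ⊥ Cops
    legalMv : ∀ i → Move G CM (play i) (play (suc i))
    follows : ∀ i → player (play i) ≡ Cops →
              play (suc i) ≡ next σ (map play (upTo i)) (play i)

-- Thief wins every infinite play; finite maximal plays end with the Thief
-- trapped (Cops always has a legal move).  Hence σ is winning for Cops iff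
-- no infinite play is consistent with σ.
Winning : (G : Graph) (CM : CopsMoveRel (Graph.n G)) → Strategy G CM → Set
Winning G CM σ = ¬ InfinitePlay G CM σ

CopsWin : (G : Graph) (CM : CopsMoveRel (Graph.n G)) → Set
CopsWin G CM = Σ (Strategy G CM) (Winning G CM)

Ent : (G : Graph) (k : ℕ) → CopsMoveRel (Graph.n G)
Ent G k = EntCopsMove k

ET : (G : Graph) (k : ℕ) → CopsMoveRel (Graph.n G)
ET G k = ETCopsMove k

-- (⇒) From a position with at most k cops every Ent move again leaves at most
-- k cops, and an Ent move ending with at most k cops is an ET move.  So a
-- winning Ent strategy σ, guarded by a plain skip for the (unreachable)
-- positions where its move would exceed the bound, is an ET strategy; every
-- play consistent with it keeps ≤ k cops, hence follows σ and is an Ent play.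
--
-- (⇐) An ET strategy σ is simulated by Ent cops who keep, next to the real
-- play, a shadow ET play with the same Thief and a shadow cop set D ⊆ C.  The
-- combinatorial core is `coverMove`: if σ wants cops X ⊆ D ∪ {g} with
-- |X| ≤ k, a single Ent move reaches some C' ⊇ X.  As the Thief avoids C ⊇ D,
-- every real Thief move is legal in the shadow play, so each infinite Ent play
-- consistent with the simulation yields one in ET consistent with σ.
module Submission where

open import Defs
open import Data.Nat using (ℕ; zero; suc; _≤_; _+_; z≤n; s≤s; _<?_; _≤?_)
open import Data.Nat.Properties
  using (≤-trans; ≤-reflexive; +-suc; +-comm; +-monoʳ-≤; n≤1+n; ≮⇒≥; <⇒≱; module ≤-Reasoning)
open import Data.Fin using (Fin)
open import Data.Fin.Properties using (any?)
open import Data.Fin.Subset using (Subset; ⊥; ⁅_⁆; _∪_; _-_; _∈_; _∉_; _⊆_; _⊂_; ∣_∣; inside; outside)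
open import Data.Fin.Subset.Properties
  using (_∈?_; ∉⊥; ∣⊥∣≡0; ∣⁅x⁆∣≡1; x∈⁅x⁆; x∈⁅y⁆⇒x≡y; p⊆p∪q; q⊆p∪q; x∈p∪q⁻; x∈p∪q⁺;
         ⊆-trans; ⊆-refl; p⊆q⇒∣p∣≤∣q∣; p⊂q⇒∣p∣<∣q∣; p─q⊆p; x∈p∧x≢y⇒x∈p-y; x∈p⇒∣p-x∣<∣p∣)
open import Data.Vec using ([]; _∷_)
open import Data.List using (List; []; map; upTo; applyUpTo; foldl; _∷ʳ_)
open import Data.List.Properties using (foldl-∷ʳ; applyUpTo-∷ʳ; map-upTo)
open import Data.Product using (Σ; ∃; _×_; _,_; proj₁; proj₂)
open import Data.Sum using (_⊎_; inj₁; inj₂; [_,_]; map₁)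
open import Relation.Binary.PropositionalEquality
  using (_≡_; refl; sym; trans; cong; subst; subst₂; module ≡-Reasoning)
open import Relation.Nullary using (¬_; yes; no; contradiction)
open import Relation.Nullary.Decidable using (_×-dec_; ¬?)

∣p∪q∣≤∣p∣+∣q∣ : ∀ {n} (p q : Subset n) → ∣ p ∪ q ∣ ≤ ∣ p ∣ + ∣ q ∣
∣p∪q∣≤∣p∣+∣q∣ []            []            = z≤n
∣p∪q∣≤∣p∣+∣q∣ (outside ∷ p) (outside ∷ q) = ∣p∪q∣≤∣p∣+∣q∣ p q
∣p∪q∣≤∣p∣+∣q∣ (outside ∷ p) (inside  ∷ q) =
  ≤-trans (s≤s (∣p∪q∣≤∣p∣+∣q∣ p q)) (≤-reflexive (sym (+-suc ∣ p ∣ ∣ q ∣)))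
∣p∪q∣≤∣p∣+∣q∣ (inside  ∷ p) (outside ∷ q) = s≤s (∣p∪q∣≤∣p∣+∣q∣ p q)
∣p∪q∣≤∣p∣+∣q∣ (inside  ∷ p) (inside  ∷ q) =
  s≤s (≤-trans (∣p∪q∣≤∣p∣+∣q∣ p q) (+-monoʳ-≤ ∣ p ∣ (n≤1+n ∣ q ∣)))

module _ {n : ℕ} where

  ∣p∪⁅x⁆∣≤1+∣p∣ : (p : Subset n) (x : Fin n) → ∣ p ∪ ⁅ x ⁆ ∣ ≤ suc ∣ p ∣
  ∣p∪⁅x⁆∣≤1+∣p∣ p x = begin
    ∣ p ∪ ⁅ x ⁆ ∣     ≤⟨ ∣p∪q∣≤∣p∣+∣q∣ p ⁅ x ⁆ ⟩
    ∣ p ∣ + ∣ ⁅ x ⁆ ∣ ≡⟨ cong (∣ p ∣ +_) (∣⁅x⁆∣≡1 x) ⟩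
    ∣ p ∣ + 1         ≡⟨ +-comm ∣ p ∣ 1 ⟩
    suc ∣ p ∣         ∎
    where open ≤-Reasoning

  ∣p∪⁅x⁆∣≤∣p∣⇒x∈p : {p : Subset n} {x : Fin n} → ∣ p ∪ ⁅ x ⁆ ∣ ≤ ∣ p ∣ → x ∈ p
  ∣p∪⁅x⁆∣≤∣p∣⇒x∈p {p} {x} noGrowth with x ∈? p
  ... | yes x∈p = x∈p
  ... | no  x∉p = contradiction noGrowth (<⇒≱ (p⊂q⇒∣p∣<∣q∣ p⊂p∪⁅x⁆))
    where
    p⊂p∪⁅x⁆ : p ⊂ p ∪ ⁅ x ⁆
    p⊂p∪⁅x⁆ = p⊆p∪q ⁅ x ⁆ , x , x∈p∪q⁺ (inj₂ (x∈⁅x⁆ x)) , x∉p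

  ∣⊥∣≤ : (k : ℕ) → ∣ ⊥ {n = n} ∣ ≤ k
  ∣⊥∣≤ k = subst (_≤ k) (sym (∣⊥∣≡0 n)) z≤n

  ∪-⊆ : {p q r : Subset n} → p ⊆ r → q ⊆ r → p ∪ q ⊆ r
  ∪-⊆ {p} {q} p⊆r q⊆r x∈p∪q = [ p⊆r , q⊆r ] (x∈p∪q⁻ p q x∈p∪q)

  ∪-monoˡ-⊆ : {p q r : Subset n} → p ⊆ q → p ∪ r ⊆ q ∪ r
  ∪-monoˡ-⊆ {q = q} {r} p⊆q = ∪-⊆ (λ x∈p → p⊆p∪q r (p⊆q x∈p)) (q⊆p∪q q r)

  x∈p⇒⁅x⁆⊆p : {p : Subset n} {x : Fin n} → x ∈ p → ⁅ x ⁆ ⊆ p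
  x∈p⇒⁅x⁆⊆p {p} {x} x∈p y∈⁅x⁆ = subst (_∈ p) (sym (x∈⁅y⁆⇒x≡y x y∈⁅x⁆)) x∈p

  ⊆∪⁅x⁆∧x∈q⇒⊆ : {p q : Subset n} {x : Fin n} → p ⊆ q ∪ ⁅ x ⁆ → x ∈ q → p ⊆ q
  ⊆∪⁅x⁆∧x∈q⇒⊆ p⊆ x∈q = ⊆-trans p⊆ (∪-⊆ ⊆-refl (x∈p⇒⁅x⁆⊆p x∈q))

  ⊆∪⁅x⁆∧x∉p⇒⊆ : {p q : Subset n} {x : Fin n} → p ⊆ q ∪ ⁅ x ⁆ → x ∉ p → p ⊆ q
  ⊆∪⁅x⁆∧x∉p⇒⊆ {p} {q} {x} p⊆ x∉p {y} y∈p = [ (λ y∈q → y∈q) , y∉⁅x⁆ ] (x∈p∪q⁻ q ⁅ x ⁆ (p⊆ y∈p))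
    where
    y∉⁅x⁆ : y ∈ ⁅ x ⁆ → y ∈ q
    y∉⁅x⁆ y∈⁅x⁆ = contradiction (subst (_∈ p) (x∈⁅y⁆⇒x≡y x y∈⁅x⁆) y∈p) x∉p

  ⊆-drop : {p q : Subset n} {x y : Fin n} → p ⊆ q ∪ ⁅ x ⁆ → y ∉ p → p ⊆ (q - y) ∪ ⁅ x ⁆
  ⊆-drop {q = q} {x} p⊆ y∉p z∈p =
    x∈p∪q⁺ (map₁ (λ z∈q → x∈p∧x≢y⇒x∈p-y z∈q λ { refl → y∉p z∈p }) (x∈p∪q⁻ q ⁅ x ⁆ (p⊆ z∈p)))

  ¬∃∖⇒⊆ : {p q : Subset n} → ¬ (∃ λ x → x ∈ p × x ∉ q) → p ⊆ q
  ¬∃∖⇒⊆ {q = q} noneOutside {x} x∈p with x ∈? q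
  ... | yes x∈q = x∈q
  ... | no  x∉q = contradiction (x , x∈p , x∉q) noneOutside

whoseTurn : ∀ {n} (p : Pos n) → player p ≡ Cops ⊎ player p ≡ Thief
whoseTurn (pos _ _ Cops)  = inj₁ refl
whoseTurn (pos _ _ Thief) = inj₂ refl

withCops : ∀ {n} → Subset n → Pos n → Pos n
withCops D p = pos (thief p) D (player p)

record IsCopsStep {n} (p q : Pos n) : Set where
  field
    atCops     : player p ≡ Cops
    toThief    : player q ≡ Thief
    thiefStays : thief q ≡ thief p

withCops-step : ∀ {n} {p q : Pos n} {D D′ : Subset n} →
                IsCopsStep p q → IsCopsStep (withCops D p) (withCops D′ q)
withCops-step s = record { atCops = atCops ; toThief = toThief ; thiefStays = thiefStays }
  where open IsCopsStep s

copsStep-≡ : ∀ {n} {p q q′ : Pos n} → IsCopsStep p q → IsCopsStep p q′ → cops q ≡ cops q′ → q ≡ q′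
copsStep-≡ {q = pos _ _ _} {pos _ _ _} s s′ refl
  with refl ← trans (IsCopsStep.thiefStays s) (sym (IsCopsStep.thiefStays s′))
     | refl ← trans (IsCopsStep.toThief s) (sym (IsCopsStep.toThief s′)) = refl

entStep : ∀ {n k} {p q : Pos n} → EntCopsMove k p q → IsCopsStep p q
entStep skip          = record { atCops = refl ; toThief = refl ; thiefStays = refl }
entStep (add _)       = record { atCops = refl ; toThief = refl ; thiefStays = refl }
entStep (replace _ _) = record { atCops = refl ; toThief = refl ; thiefStays = refl }

etStep : ∀ {n k} {p q : Pos n} → ETCopsMove k p q → IsCopsStep p q
etStep (gskip _ _)      = record { atCops = refl ; toThief = refl ; thiefStays = refl }
etStep (greplace _ _ _) = record { atCops = refl ; toThief = refl ; thiefStays = refl }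

ent-bounded : ∀ {n k} {p q : Pos n} → EntCopsMove k p q → ∣ cops p ∣ ≤ k → ∣ cops q ∣ ≤ k
ent-bounded skip b = b
ent-bounded {p = pos g C _} (add |C|<k) _ = ≤-trans (∣p∪⁅x⁆∣≤1+∣p∣ C g) |C|<k
ent-bounded {p = pos g C _} (replace x x∈C) b =
  ≤-trans (∣p∪⁅x⁆∣≤1+∣p∣ (C - x) g) (≤-trans (x∈p⇒∣p-x∣<∣p∣ x∈C) b)

ent⇒et : ∀ {n k} {p q : Pos n} → EntCopsMove k p q → ∣ cops q ∣ ≤ k → ETCopsMove k p q
ent⇒et skip            _ = gskip _ ⊆-refl
ent⇒et (add _)         b = greplace _ ⊆-refl b
ent⇒et (replace _ _)   b = greplace _ (p─q⊆p _ _) b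

et-bounded : ∀ {n k} {p q : Pos n} → ETCopsMove k p q → ∣ cops p ∣ ≤ k → ∣ cops q ∣ ≤ k
et-bounded (gskip _ C′⊆C)  b = ≤-trans (p⊆q⇒∣p∣≤∣q∣ C′⊆C) b
et-bounded (greplace _ _ b) _ = b

et-⊆ : ∀ {n k} {p q : Pos n} → ETCopsMove k p q → cops q ⊆ cops p ∪ ⁅ thief p ⁆
et-⊆ {p = pos g _ _} (gskip _ C′⊆C)     = λ x∈C′ → p⊆p∪q ⁅ g ⁆ (C′⊆C x∈C′)
et-⊆ {p = pos g _ _} (greplace _ C′⊆C _) = ∪-monoˡ-⊆ C′⊆C

thief-keepsCops : ∀ {G p q} → ThiefMove G p q → cops q ≡ cops p
thief-keepsCops (move _ _) = refl

shadowThief : ∀ {G p q} {D : Subset (Graph.n G)} →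
              ThiefMove G p q → D ⊆ cops p → ThiefMove G (withCops D p) (withCops D q)
shadowThief (move e g′∉C) D⊆C = move e (λ g′∈D → g′∉C (D⊆C g′∈D))

module _ {G : Graph} {CM : CopsMoveRel (Graph.n G)} where

  copsTurn : ∀ {p q} → player p ≡ Cops → Move G CM p q → CM p q
  copsTurn _  (copsMove m)             = m
  copsTurn () (thiefMove (move _ _))

  thiefTurn : (∀ {a b} → CM a b → player a ≡ Cops) →
              ∀ {p q} → player p ≡ Thief → Move G CM p q → ThiefMove G p q
  thiefTurn copsAtCops pt (copsMove m) with () ← trans (sym pt) (copsAtCops m)
  thiefTurn _          _  (thiefMove t) = t

etMove-bounded : ∀ {G k p q} → Move G (ET G k) p q → ∣ cops p ∣ ≤ k → ∣ cops q ∣ ≤ k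
etMove-bounded (copsMove m)  b = et-bounded m b
etMove-bounded (thiefMove t) b = subst (λ C → ∣ C ∣ ≤ _) (sym (thief-keepsCops t)) b

map-upTo-suc : ∀ {A : Set} (f : ℕ → A) i → map f (upTo (suc i)) ≡ map f (upTo i) ∷ʳ f i
map-upTo-suc f i = begin
  map f (upTo (suc i))    ≡⟨ map-upTo f (suc i) ⟩
  applyUpTo f (suc i)     ≡⟨ sym (applyUpTo-∷ʳ f i) ⟩
  applyUpTo f i ∷ʳ f i    ≡⟨ cong (_∷ʳ f i) (sym (map-upTo f i)) ⟩
  map f (upTo i) ∷ʳ f i   ∎
  where open ≡-Reasoning

coverMove : ∀ {n} k (g : Fin n) (C X : Subset n) → Σ (Pos n) (EntCopsMove k (pos g C Cops))
coverMove k g C X with g ∈? X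
... | no  _ = _ , skip
... | yes _ with ∣ C ∣ <? k
...   | yes |C|<k = _ , add |C|<k
...   | no  _ with any? (λ x → x ∈? C ×-dec ¬? (x ∈? X))
...     | yes (x , x∈C , _) = _ , replace x x∈C
...     | no  _ = _ , skip

-- Any X ⊆ C ∪ {g} with |X| ≤ k is covered after the covering move.  In the
-- last case C ⊆ X, so |C ∪ {g}| ≤ |X| ≤ k ≤ |C| forces g ∈ C.
coverMove-covers : ∀ {n} k (g : Fin n) (C X : Subset n) →
                   X ⊆ C ∪ ⁅ g ⁆ → ∣ X ∣ ≤ k → X ⊆ cops (proj₁ (coverMove k g C X))
coverMove-covers k g C X X⊆ |X|≤k with g ∈? X
... | no  g∉X = ⊆∪⁅x⁆∧x∉p⇒⊆ X⊆ g∉X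
... | yes g∈X with ∣ C ∣ <? k
...   | yes _ = X⊆
...   | no  |C|≮k with any? (λ x → x ∈? C ×-dec ¬? (x ∈? X))
...     | yes (_ , _ , x∉X) = ⊆-drop X⊆ x∉X
...     | no  noneSpare = ⊆∪⁅x⁆∧x∈q⇒⊆ X⊆ g∈C
  where
  open ≤-Reasoning
  g∈C : g ∈ C
  g∈C = ∣p∪⁅x⁆∣≤∣p∣⇒x∈p (begin
    ∣ C ∪ ⁅ g ⁆ ∣ ≤⟨ p⊆q⇒∣p∣≤∣q∣ (∪-⊆ (¬∃∖⇒⊆ noneSpare) (x∈p⇒⁅x⁆⊆p g∈X)) ⟩
    ∣ X ∣         ≤⟨ |X|≤k ⟩
    k             ≤⟨ ≮⇒≥ |C|≮k ⟩
    ∣ C ∣         ∎)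

module EntToET (G : Graph) (k : ℕ) (σ : Strategy G (Ent G k)) where

  guarded : Strategy G (ET G k)
  next guarded h p with ∣ cops (next σ h p) ∣ ≤? k
  ... | yes _ = next σ h p
  ... | no  _ = pos (thief p) (cops p) Thief
  legal guarded h (pos g C Cops) refl with ∣ cops (next σ h (pos g C Cops)) ∣ ≤? k
  ... | yes bounded = ent⇒et (legal σ h (pos g C Cops) refl) bounded
  ... | no  _       = gskip C ⊆-refl

  guarded-agrees : ∀ h p → player p ≡ Cops → ∣ cops p ∣ ≤ k → next guarded h p ≡ next σ h p
  guarded-agrees h p pc b with ∣ cops (next σ h p) ∣ ≤? k
  ... | yes _         = refl
  ... | no  unbounded = contradiction (ent-bounded (legal σ h p pc) b) unbounded

  module _ (ρ : InfinitePlay G (ET G k) guarded) where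
    open InfinitePlay ρ

    bounded : ∀ i → ∣ cops (play i) ∣ ≤ k
    bounded zero    = subst (λ p → ∣ cops p ∣ ≤ k) (sym (proj₂ start)) (∣⊥∣≤ {n = Graph.n G} k)
    bounded (suc i) = etMove-bounded (legalMv i) (bounded i)

    follows-σ : ∀ i → player (play i) ≡ Cops → play (suc i) ≡ next σ (map play (upTo i)) (play i)
    follows-σ i pc = trans (follows i pc) (guarded-agrees _ (play i) pc (bounded i))

    entLegal : ∀ i → Move G (Ent G k) (play i) (play (suc i))
    entLegal i with whoseTurn (play i)
    ... | inj₁ pc = copsMove (subst (EntCopsMove k (play i)) (sym (follows-σ i pc)) (legal σ _ (play i) pc))
    ... | inj₂ pt = thiefMove (thiefTurn (λ m → IsCopsStep.atCops (etStep m)) pt (legalMv i))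

    asEntPlay : InfinitePlay G (Ent G k) σ
    asEntPlay = record { play = play ; start = start ; legalMv = entLegal ; follows = follows-σ }

module ETToEnt (G : Graph) (k : ℕ) (σ : Strategy G (ET G k)) where
  private
    N = Graph.n G
    P = Pos N

  record Shadow : Set where
    field
      shadowPast : List P
      shadowCops : Subset N
  open Shadow

  σTarget : Shadow → P → Subset N
  σTarget s p = cops (next σ (shadowPast s) (withCops (shadowCops s) p))

  shadowCopsAfter : Player → Shadow → P → Subset N
  shadowCopsAfter Cops  s p = σTarget s p
  shadowCopsAfter Thief s p = shadowCops s

  shadowStep : Shadow → P → Shadow
  shadowStep s p = record
    { shadowPast = shadowPast s ∷ʳ withCops (shadowCops s) p
    ; shadowCops = shadowCopsAfter (player p) s p }

  shadowOf : List P → Shadow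
  shadowOf = foldl shadowStep (record { shadowPast = [] ; shadowCops = ⊥ })

  simulation : Strategy G (Ent G k)
  next  simulation h p = proj₁ (coverMove k (thief p) (cops p) (σTarget (shadowOf h) p))
  legal simulation h (pos g C Cops) refl = proj₂ (coverMove k g C (σTarget (shadowOf h) (pos g C Cops)))

  module _ (π : InfinitePlay G (Ent G k) simulation) where
    open InfinitePlay π

    shadowAt : ℕ → Shadow
    shadowAt i = shadowOf (map play (upTo i))

    D : ℕ → Subset N
    D i = shadowCops (shadowAt i)

    ρ : ℕ → P
    ρ i = withCops (D i) (play i)

    shadowAt-suc : ∀ i → shadowAt (suc i) ≡ shadowStep (shadowAt i) (play i)
    shadowAt-suc i = begin
      shadowOf (map play (upTo (suc i)))     ≡⟨ cong shadowOf (map-upTo-suc play i) ⟩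
      shadowOf (map play (upTo i) ∷ʳ play i) ≡⟨ foldl-∷ʳ shadowStep _ (play i) (map play (upTo i)) ⟩
      shadowStep (shadowAt i) (play i)       ∎
      where open ≡-Reasoning

    shadowPast-≡ : ∀ i → shadowPast (shadowAt i) ≡ map ρ (upTo i)
    shadowPast-≡ zero    = refl
    shadowPast-≡ (suc i) = begin
      shadowPast (shadowAt (suc i))   ≡⟨ cong shadowPast (shadowAt-suc i) ⟩
      shadowPast (shadowAt i) ∷ʳ ρ i  ≡⟨ cong (_∷ʳ ρ i) (shadowPast-≡ i) ⟩
      map ρ (upTo i) ∷ʳ ρ i           ≡⟨ sym (map-upTo-suc ρ i) ⟩
      map ρ (upTo (suc i))            ∎
      where open ≡-Reasoning

    D-cops : ∀ i → player (play i) ≡ Cops → D (suc i) ≡ σTarget (shadowAt i) (play i)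
    D-cops i pc = trans (cong shadowCops (shadowAt-suc i))
                        (cong (λ who → shadowCopsAfter who (shadowAt i) (play i)) pc)

    D-thief : ∀ i → player (play i) ≡ Thief → D (suc i) ≡ D i
    D-thief i pt = trans (cong shadowCops (shadowAt-suc i))
                         (cong (λ who → shadowCopsAfter who (shadowAt i) (play i)) pt)

    σMove : ∀ i → player (play i) ≡ Cops → ETCopsMove k (ρ i) (next σ (shadowPast (shadowAt i)) (ρ i))
    σMove i pc = legal σ _ (ρ i) pc

    thiefStep : ∀ i → player (play i) ≡ Thief → ThiefMove G (play i) (play (suc i))
    thiefStep i pt = thiefTurn (λ m → IsCopsStep.atCops (entStep m)) pt (legalMv i)

    Covered : ℕ → Set
    Covered i = D i ⊆ cops (play i) × ∣ D i ∣ ≤ k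

    coveredAfterCops : ∀ i → player (play i) ≡ Cops → Covered i → Covered (suc i)
    coveredAfterCops i pc (D⊆C , |D|≤k) =
      subst (λ Y → Y ⊆ cops (play (suc i)) × ∣ Y ∣ ≤ k) (sym (D-cops i pc)) (X⊆C′ , |X|≤k)
      where
      X = σTarget (shadowAt i) (play i)
      |X|≤k : ∣ X ∣ ≤ k
      |X|≤k = et-bounded (σMove i pc) |D|≤k
      X⊆C∪g : X ⊆ cops (play i) ∪ ⁅ thief (play i) ⁆
      X⊆C∪g = ⊆-trans (et-⊆ (σMove i pc)) (∪-monoˡ-⊆ D⊆C)
      X⊆C′ : X ⊆ cops (play (suc i))
      X⊆C′ = subst (λ q → X ⊆ cops q) (sym (follows i pc))
                   (coverMove-covers k _ _ X X⊆C∪g |X|≤k)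

    coveredAfterThief : ∀ i → player (play i) ≡ Thief → Covered i → Covered (suc i)
    coveredAfterThief i pt (D⊆C , |D|≤k) =
      subst₂ (λ Y C → Y ⊆ C × ∣ Y ∣ ≤ k) (sym (D-thief i pt)) (sym (thief-keepsCops (thiefStep i pt)))
             (D⊆C , |D|≤k)

    covered : ∀ i → Covered i
    covered zero = (λ x∈⊥ → contradiction x∈⊥ ∉⊥) , ∣⊥∣≤ {n = N} k
    covered (suc i) with whoseTurn (play i)
    ... | inj₁ pc = coveredAfterCops  i pc (covered i)
    ... | inj₂ pt = coveredAfterThief i pt (covered i)

    shadowFollows : ∀ i → player (ρ i) ≡ Cops → ρ (suc i) ≡ next σ (map ρ (upTo i)) (ρ i)
    shadowFollows i pc = begin
      ρ (suc i)                              ≡⟨ copsStep-≡ realStep (etStep (σMove i pc)) (D-cops i pc) ⟩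
      next σ (shadowPast (shadowAt i)) (ρ i) ≡⟨ cong (λ h → next σ h (ρ i)) (shadowPast-≡ i) ⟩
      next σ (map ρ (upTo i)) (ρ i)          ∎
      where
      open ≡-Reasoning
      realStep : IsCopsStep (ρ i) (ρ (suc i))
      realStep = withCops-step (entStep (copsTurn pc (legalMv i)))

    shadowLegal : ∀ i → Move G (ET G k) (ρ i) (ρ (suc i))
    shadowLegal i with whoseTurn (play i)
    ... | inj₁ pc = copsMove (subst (ETCopsMove k (ρ i)) (sym (shadowFollows i pc)) (legal σ _ (ρ i) pc))
    ... | inj₂ pt = thiefMove (subst (λ Y → ThiefMove G (ρ i) (withCops Y (play (suc i))))
                                     (sym (D-thief i pt))
                                     (shadowThief (thiefStep i pt) (proj₁ (covered i))))

    shadowPlay : InfinitePlay G (ET G k) σ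
    shadowPlay = record
      { play    = ρ
      ; start   = proj₁ start , cong (withCops ⊥) (proj₂ start)
      ; legalMv = shadowLegal
      ; follows = shadowFollows }

mainTheorem1 : (G : Graph) (k : ℕ) →
    (CopsWin G (Ent G k) → CopsWin G (ET G k)) × (CopsWin G (ET G k) → CopsWin G (Ent G k))
mainTheorem1 G k = entToET , etToEnt
  where
  entToET : CopsWin G (Ent G k) → CopsWin G (ET G k)
  entToET (σ , σ-wins) = EntToET.guarded G k σ , λ ρ → σ-wins (EntToET.asEntPlay G k σ ρ)

  etToEnt : CopsWin G (ET G k) → CopsWin G (Ent G k)
  etToEnt (σ , σ-wins) = ETToEnt.simulation G k σ , λ π → σ-wins (ETToEnt.shadowPlay G k σ π)
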